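{- Let $\mathbb{C}, \mathbb{D}$ be small categories, $\pi : \mathbb{C}\times\mathbb{D}\to\mathbb{C}$ the projection, $\Omega$ and $\Omega^{\mathbb{D}}$ the subobject classifiers of $\widehat{\mathbb{C}}$ and $\widehat{\mathbb{C}\times\mathbb{D}}$, and $\upsilon : \pi^*(\Omega) \to \Omega^{\mathbb{D}}$ the monomorphism which is the characteristic map of the mono $\pi^*(\top) : \pi^*(1) \to \pi^*(\Omega)$ (so that $\upsilon\circ\pi^*(\top)$ corresponds to $\top$ under $\pi^*(1)\cong 1$, forming a pullback square). Let $Y \in \widehat{\mathbb{C}}$ and $X = \pi^*(Y)$. Let $\chi_\delta : X \times X \to \Omega^{\mathbb{D}}$ be the characteristic map of the diagonal $\delta : X \to X\times X$ and $\chi_{\delta'} : Y \times Y \to \Omega$ that of the diagonal $\delta' : Y \to Y \times Y$. Then $\chi_\delta$ factors uniquely through $\upsilon$, and the factorisation is $\chi_\delta = \upsilon \circ \pi^*(\chi_{\delta'})$.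
   Context: $\widehat{\mathbb{E}}$ denotes the category of presheaves on a small category $\mathbb{E}$; $\pi^*$ is precomposition with $\pi$, i.e. $\pi^*(X)(c,d) = X(c)$; it preserves finite limits, so $X \times X = \pi^*(Y\times Y)$. -}

module Defs where

-- Conventions:
--  * a small category has a Set of objects and Set-valued hom-sets with
--    propositional equality of morphisms;
--  * a presheaf is Setoid-valued (carriers in Set₁, equality in Set), so
--    that the sieve presheaf Ω lives in the same category;
--  * Ω is the standard subobject classifier of presheaves: sieves.

open import Level using (Level) renaming (zero to 0ℓ; suc to lsuc)
open import Relation.Binary.PropositionalEquality using (_≡_; refl; cong₂; subst; sym)
open import Relation.Binary.Bundles using (Setoid)
open import Relation.Binary.Structures using (IsEquivalence)
open import Data.Product using (Σ; Σ-syntax; _×_; _,_; proj₁; proj₂)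
open import Data.Product.Relation.Binary.Pointwise.NonDependent using (×-setoid)
import Data.Unit as U
import Data.Unit.Polymorphic as UP

record Category : Set₁ where
  infixr 9 _∘_
  field
    Obj       : Set
    Hom       : Obj → Obj → Set
    id        : ∀ {a} → Hom a a
    _∘_       : ∀ {a b c} → Hom b c → Hom a b → Hom a c
    identityˡ : ∀ {a b} (f : Hom a b) → id ∘ f ≡ f
    identityʳ : ∀ {a b} (f : Hom a b) → f ∘ id ≡ f
    assoc     : ∀ {a b c d} (h : Hom c d) (g : Hom b c) (f : Hom a b) →
                (h ∘ g) ∘ f ≡ h ∘ (g ∘ f)

record Functor (A B : Category) : Set where
  private
    module A = Category A
    module B = Category B
  field
    F₀    : A.Obj → B.Obj
    F₁    : ∀ {a b} → A.Hom a b → B.Hom (F₀ a) (F₀ b)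
    F-id  : ∀ {a} → F₁ (A.id {a}) ≡ B.id
    F-∘   : ∀ {a b c} (g : A.Hom b c) (f : A.Hom a b) →
            F₁ (g A.∘ f) ≡ F₁ g B.∘ F₁ f

_⊗_ : Category → Category → Category
C ⊗ D = record
  { Obj       = C.Obj × D.Obj
  ; Hom       = λ x y → C.Hom (proj₁ x) (proj₁ y) × D.Hom (proj₂ x) (proj₂ y)
  ; id        = C.id , D.id
  ; _∘_       = λ g f → (proj₁ g C.∘ proj₁ f) , (proj₂ g D.∘ proj₂ f)
  ; identityˡ = λ f → cong₂ _,_ (C.identityˡ (proj₁ f)) (D.identityˡ (proj₂ f))
  ; identityʳ = λ f → cong₂ _,_ (C.identityʳ (proj₁ f)) (D.identityʳ (proj₂ f))
  ; assoc     = λ h g f → cong₂ _,_ (C.assoc (proj₁ h) (proj₁ g) (proj₁ f))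
                                    (D.assoc (proj₂ h) (proj₂ g) (proj₂ f))
  }
  where
    module C = Category C
    module D = Category D

proj : (C D : Category) → Functor (C ⊗ D) C
proj C D = record
  { F₀   = proj₁
  ; F₁   = proj₁
  ; F-id = refl
  ; F-∘  = λ g f → refl
  }

record Presheaf (C : Category) : Set₂ where
  open Category C
  field
    F₀   : Obj → Setoid (lsuc 0ℓ) 0ℓ
  Carrier : Obj → Set₁
  Carrier a = Setoid.Carrier (F₀ a)
  _≈_ : ∀ {a} → Carrier a → Carrier a → Set
  _≈_ {a} = Setoid._≈_ (F₀ a)
  field
    F₁      : ∀ {a b} → Hom a b → Carrier b → Carrier a
    F₁-cong : ∀ {a b} (f : Hom a b) {x y : Carrier b} → x ≈ y → F₁ f x ≈ F₁ f y
    F-id    : ∀ {a} (x : Carrier a) → F₁ (id {a}) x ≈ x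
    F-∘     : ∀ {a b c} (g : Hom b c) (f : Hom a b) (x : Carrier c) →
              F₁ (g ∘ f) x ≈ F₁ f (F₁ g x)

infix 4 _⇒_
record _⇒_ {C : Category} (P Q : Presheaf C) : Set₁ where
  open Category C
  private
    module P = Presheaf P
    module Q = Presheaf Q
  field
    η       : ∀ a → P.Carrier a → Q.Carrier a
    η-cong  : ∀ a {x y : P.Carrier a} → x P.≈ y → η a x Q.≈ η a y
    natural : ∀ {a b} (f : Hom a b) (x : P.Carrier b) →
              η a (P.F₁ f x) Q.≈ Q.F₁ f (η b x)

infix 4 _≈ⁿ_
_≈ⁿ_ : ∀ {C} {P Q : Presheaf C} → P ⇒ Q → P ⇒ Q → Set₁
_≈ⁿ_ {C} {P} {Q} α β =
  ∀ a (x : Presheaf.Carrier P a) → Presheaf._≈_ Q (_⇒_.η α a x) (_⇒_.η β a x)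

infixr 9 _∘ⁿ_
_∘ⁿ_ : ∀ {C} {P Q R : Presheaf C} → Q ⇒ R → P ⇒ Q → P ⇒ R
_∘ⁿ_ {C} {P} {Q} {R} β α = record
  { η       = λ a x → β.η a (α.η a x)
  ; η-cong  = λ a e → β.η-cong a (α.η-cong a e)
  ; natural = λ {a} {b} f x →
      Setoid.trans (Presheaf.F₀ R a) (β.η-cong a (α.natural f x)) (β.natural f (α.η b x))
  }
  where
    module α = _⇒_ α
    module β = _⇒_ β

_^* : ∀ {A B} → Functor A B → Presheaf B → Presheaf A
_^* {A} {B} F P = record
  { F₀      = λ a → P.F₀ (F.F₀ a)
  ; F₁      = λ f → P.F₁ (F.F₁ f)
  ; F₁-cong = λ f → P.F₁-cong (F.F₁ f)
  ; F-id    = λ {a} x → Setoid.trans (P.F₀ (F.F₀ a))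
                 (subst (λ h → P.F₁ h x P.≈ P.F₁ (Category.id B) x) (sym F.F-id)
                        (Setoid.refl (P.F₀ (F.F₀ a))))
                 (P.F-id x)
  ; F-∘     = λ {a} g f x → Setoid.trans (P.F₀ (F.F₀ a))
                 (subst (λ h → P.F₁ h x P.≈ P.F₁ (Category._∘_ B (F.F₁ g) (F.F₁ f)) x)
                        (sym (F.F-∘ g f)) (Setoid.refl (P.F₀ (F.F₀ a))))
                 (P.F-∘ (F.F₁ g) (F.F₁ f) x)
  }
  where
    module P = Presheaf P
    module F = Functor F

_^*₁ : ∀ {A B} (F : Functor A B) {P Q : Presheaf B} → P ⇒ Q → (F ^*) P ⇒ (F ^*) Q
_^*₁ F α = record
  { η       = λ a → α.η (Functor.F₀ F a)
  ; η-cong  = λ a → α.η-cong (Functor.F₀ F a)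
  ; natural = λ f → α.natural (Functor.F₁ F f)
  }
  where module α = _⇒_ α

unitSetoid : Setoid (lsuc 0ℓ) 0ℓ
unitSetoid = record
  { Carrier       = UP.⊤
  ; _≈_           = λ _ _ → U.⊤
  ; isEquivalence = record { refl = U.tt ; sym = λ _ → U.tt ; trans = λ _ _ → U.tt }
  }

𝟙 : (C : Category) → Presheaf C
𝟙 C = record
  { F₀      = λ _ → unitSetoid
  ; F₁      = λ _ x → x
  ; F₁-cong = λ _ e → e
  ; F-id    = λ _ → U.tt
  ; F-∘     = λ _ _ _ → U.tt
  }

! : ∀ {C} (P : Presheaf C) → P ⇒ 𝟙 C
! P = record { η = λ _ _ → UP.tt ; η-cong = λ _ _ → U.tt ; natural = λ _ _ → U.tt }

infixr 5 _×ₚ_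
_×ₚ_ : ∀ {C} → Presheaf C → Presheaf C → Presheaf C
P ×ₚ Q = record
  { F₀      = λ a → ×-setoid (P.F₀ a) (Q.F₀ a)
  ; F₁      = λ f x → P.F₁ f (proj₁ x) , Q.F₁ f (proj₂ x)
  ; F₁-cong = λ f e → P.F₁-cong f (proj₁ e) , Q.F₁-cong f (proj₂ e)
  ; F-id    = λ x → P.F-id (proj₁ x) , Q.F-id (proj₂ x)
  ; F-∘     = λ g f x → P.F-∘ g f (proj₁ x) , Q.F-∘ g f (proj₂ x)
  }
  where
    module P = Presheaf P
    module Q = Presheaf Q

diag : ∀ {C} (P : Presheaf C) → P ⇒ P ×ₚ P
diag P = record
  { η       = λ a x → x , x
  ; η-cong  = λ a e → e , e
  ; natural = λ {a} f x → Setoid.refl (Presheaf.F₀ P a) , Setoid.refl (Presheaf.F₀ P a)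
  }

record IsPullback {C : Category} {P A B Z : Presheaf C}
                  (p : P ⇒ A) (q : P ⇒ B) (f : A ⇒ Z) (g : B ⇒ Z) : Set₃ where
  field
    commute   : f ∘ⁿ p ≈ⁿ g ∘ⁿ q
    universal : (W : Presheaf C) (a : W ⇒ A) (b : W ⇒ B) → f ∘ⁿ a ≈ⁿ g ∘ⁿ b →
                Σ[ u ∈ W ⇒ P ] ((p ∘ⁿ u ≈ⁿ a) × (q ∘ⁿ u ≈ⁿ b))
    unique    : (W : Presheaf C) (u v : W ⇒ P) →
                p ∘ⁿ u ≈ⁿ p ∘ⁿ v → q ∘ⁿ u ≈ⁿ q ∘ⁿ v → u ≈ⁿ v

record Sieve (C : Category) (c : Category.Obj C) : Set₁ where
  open Category C
  field
    mem    : ∀ {d} → Hom d c → Set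
    closed : ∀ {d e} (f : Hom d c) (g : Hom e d) → mem f → mem (f ∘ g)

_≈ˢ_ : ∀ {C c} → Sieve C c → Sieve C c → Set
_≈ˢ_ {C} {c} S T =
  ∀ {d} (f : Category.Hom C d c) → (Sieve.mem S f → Sieve.mem T f) × (Sieve.mem T f → Sieve.mem S f)

SieveSetoid : (C : Category) (c : Category.Obj C) → Setoid (lsuc 0ℓ) 0ℓ
SieveSetoid C c = record
  { Carrier       = Sieve C c
  ; _≈_           = _≈ˢ_
  ; isEquivalence = record
      { refl  = λ f → (λ x → x) , (λ x → x)
      ; sym   = λ e f → proj₂ (e f) , proj₁ (e f)
      ; trans = λ e e′ f → (λ x → proj₁ (e′ f) (proj₁ (e f) x))
                         , (λ x → proj₂ (e f) (proj₂ (e′ f) x))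
      }
  }

pullSieve : ∀ {C} {a b} → Category.Hom C a b → Sieve C b → Sieve C a
pullSieve {C} g S = record
  { mem    = λ h → S.mem (g ∘ h)
  ; closed = λ f h m → subst S.mem (assoc g f h) (S.closed (g ∘ f) h m)
  }
  where
    open Category C
    module S = Sieve S

Ω : (C : Category) → Presheaf C
Ω C = record
  { F₀      = SieveSetoid C
  ; F₁      = pullSieve
  ; F₁-cong = λ g e h → e (g ∘ h)
  ; F-id    = λ S h → subst (Sieve.mem S) (identityˡ h)
                    , subst (Sieve.mem S) (sym (identityˡ h))
  ; F-∘     = λ g f S h → subst (Sieve.mem S) (assoc g f h)
                        , subst (Sieve.mem S) (sym (assoc g f h))
  }
  where open Category C

true : (C : Category) → 𝟙 C ⇒ Ω C
true C = record
  { η       = λ a _ → record { mem = λ _ → U.⊤ ; closed = λ _ _ _ → U.tt }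
  ; η-cong  = λ a _ f → (λ _ → U.tt) , (λ _ → U.tt)
  ; natural = λ f _ g → (λ _ → U.tt) , (λ _ → U.tt)
  }

IsCharacteristic : ∀ {C} {A B : Presheaf C} → A ⇒ B → B ⇒ Ω C → Set₃
IsCharacteristic {C} {A} m χ = IsPullback m (! A) χ (true C)

module Submission where

-- In presheaves, a characteristic map χ : B → Ω of a mono
-- m : A → B is determined by a concrete formula: a morphism f : d → c lies
-- in the sieve χ(x) exactly when the restriction x·f lies in the image of m
-- (lemma Characteristic.member⇔in-image, proved from the pullback property
-- by testing against the subpresheaf of B on which χ is true).
-- Two instances of this formula are computed:
--   * for the diagonal of P, f ∈ χ(x, y) iff x·f ≈ y·f;
--   * for υ, characteristic of F^*(true) for a functor F, h ∈ υ(S) iff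
--     F(h) ∈ S.
-- For F = π these show that both χδ and υ ∘ π^*(χδ′) send (x, y) to the
-- sieve of those (f, g) with x·f ≈ y·f, giving the factorisation; and
-- that υ is a monomorphism (test membership at (f, id)), giving uniqueness.

open import Defs
open import Data.Product using (_×_; Σ-syntax; _,_; proj₁; proj₂)
open import Function.Bundles using (_⇔_; mk⇔; Equivalence)
import Function.Properties.Equivalence as ⇔
import Relation.Binary.PropositionalEquality as ≡
open import Relation.Binary.Bundles using (Setoid)
import Data.Unit as U
import Data.Unit.Polymorphic as UP

≈ⁿ-sym : ∀ {C} {P Q : Presheaf C} {α β : P ⇒ Q} → α ≈ⁿ β → β ≈ⁿ α
≈ⁿ-sym {Q = Q} e a x = Setoid.sym (Presheaf.F₀ Q a) (e a x)

≈ⁿ-trans : ∀ {C} {P Q : Presheaf C} {α β γ : P ⇒ Q} → α ≈ⁿ β → β ≈ⁿ γ → α ≈ⁿ γ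
≈ⁿ-trans {Q = Q} e e′ a x = Setoid.trans (Presheaf.F₀ Q a) (e a x) (e′ a x)

module _ {C : Category} where
  open Category C

  sieve-ext : ∀ {c} {S T : Sieve C c} →
              (∀ {d} (f : Hom d c) → Sieve.mem S f ⇔ Sieve.mem T f) → S ≈ˢ T
  sieve-ext e f = Equivalence.to (e f) , Equivalence.from (e f)

  ≈ˢ⇒member⇔ : ∀ {c d} {S T : Sieve C c} → S ≈ˢ T →
               (f : Hom d c) → Sieve.mem S f ⇔ Sieve.mem T f
  ≈ˢ⇒member⇔ e f = mk⇔ (proj₁ (e f)) (proj₂ (e f))

  id-member⇒member : ∀ {c d} (S : Sieve C c) (h : Hom d c) →
                     Sieve.mem S id → Sieve.mem S h
  id-member⇒member S h p = ≡.subst (Sieve.mem S) (identityˡ h) (Sieve.closed S id h p)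

  member⇔pullback-maximal : ∀ {c d} (S : Sieve C c) (h : Hom d c) →
    Sieve.mem S h ⇔ (_⇒_.η (true C) d UP.tt ≈ˢ pullSieve h S)
  member⇔pullback-maximal S h = mk⇔
    (λ p {_} k → (λ _ → Sieve.closed S h k p) , (λ _ → U.tt))
    (λ e → ≡.subst (Sieve.mem S) (identityʳ h) (proj₁ (e id) U.tt))

module Characteristic {C : Category} {A B : Presheaf C} (m : A ⇒ B) (χ : B ⇒ Ω C)
                      (isχ : IsCharacteristic m χ) where
  open Category C
  private
    module A = Presheaf A
    module B = Presheaf B
    module m = _⇒_ m
    module χ = _⇒_ χ
  open IsPullback isχ

  member⇔restriction-true : ∀ {c d} (x : B.Carrier c) (f : Hom d c) →
    Sieve.mem (χ.η c x) f ⇔ Sieve.mem (χ.η d (B.F₁ f x)) id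
  member⇔restriction-true x f = mk⇔
    (λ p → proj₂ (χ.natural f x id) (≡.subst (Sieve.mem (χ.η _ x)) (≡.sym (identityʳ f)) p))
    (λ p → ≡.subst (Sieve.mem (χ.η _ x)) (identityʳ f) (proj₁ (χ.natural f x id) p))

  Extent : Presheaf C
  Extent = record
    { F₀      = λ c → record
        { Carrier       = Σ[ y ∈ B.Carrier c ] Sieve.mem (χ.η c y) id
        ; _≈_           = λ p q → proj₁ p B.≈ proj₁ q
        ; isEquivalence = record
            { refl  = Setoid.refl (B.F₀ c)
            ; sym   = Setoid.sym (B.F₀ c)
            ; trans = Setoid.trans (B.F₀ c)
            }
        }
    ; F₁      = λ h p → B.F₁ h (proj₁ p)
                      , Equivalence.to (member⇔restriction-true (proj₁ p) h)
                          (id-member⇒member (χ.η _ (proj₁ p)) h (proj₂ p))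
    ; F₁-cong = λ h → B.F₁-cong h
    ; F-id    = λ p → B.F-id (proj₁ p)
    ; F-∘     = λ g f p → B.F-∘ g f (proj₁ p)
    }

  extent-incl : Extent ⇒ B
  extent-incl = record
    { η       = λ c → proj₁
    ; η-cong  = λ c e → e
    ; natural = λ {c} f p → Setoid.refl (B.F₀ c)
    }

  extent-true : χ ∘ⁿ extent-incl ≈ⁿ true C ∘ⁿ ! Extent
  extent-true c (y , p) h = (λ _ → U.tt) , (λ _ → id-member⇒member (χ.η c y) h p)

  extent-lift : Extent ⇒ A
  extent-lift = proj₁ (universal Extent extent-incl (! Extent) extent-true)

  extent-lift-section : m ∘ⁿ extent-lift ≈ⁿ extent-incl
  extent-lift-section = proj₁ (proj₂ (universal Extent extent-incl (! Extent) extent-true))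

  member⇔in-image : ∀ {c d} (x : B.Carrier c) (f : Hom d c) →
    Sieve.mem (χ.η c x) f ⇔ (Σ[ z ∈ A.Carrier d ] m.η d z B.≈ B.F₁ f x)
  member⇔in-image {d = d} x f = mk⇔ to from
    where
      to : Sieve.mem (χ.η _ x) f → Σ[ z ∈ A.Carrier d ] m.η d z B.≈ B.F₁ f x
      to p = _⇒_.η extent-lift d x·f , extent-lift-section d x·f
        where
          x·f : Presheaf.Carrier Extent d
          x·f = B.F₁ f x , Equivalence.to (member⇔restriction-true x f) p
      -- the square commutes, so χ is true at every m(z)
      from : (Σ[ z ∈ A.Carrier d ] m.η d z B.≈ B.F₁ f x) → Sieve.mem (χ.η _ x) f
      from (z , e) = Equivalence.from (member⇔restriction-true x f)
        (proj₁ (χ.η-cong d e id) (proj₂ (commute d z id) U.tt))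

diagonal-member : ∀ {C} (P : Presheaf C) (χ : P ×ₚ P ⇒ Ω C) →
  IsCharacteristic (diag P) χ →
  ∀ {c d} (x : Presheaf.Carrier (P ×ₚ P) c) (f : Category.Hom C d c) →
  Sieve.mem (_⇒_.η χ c x) f ⇔ Presheaf._≈_ P (Presheaf.F₁ P f (proj₁ x)) (Presheaf.F₁ P f (proj₂ x))
diagonal-member P χ isχ {d = d} x f =
  ⇔.trans (Characteristic.member⇔in-image (diag P) χ isχ x f)
          (mk⇔ (λ { (z , e₁ , e₂) → trans (sym e₁) e₂ }) (λ e → _ , refl , e))
  where open Setoid (Presheaf.F₀ P d) using (refl; sym; trans)

inverse-image-member : ∀ {A B} (F : Functor A B) (υ : (F ^*) (Ω B) ⇒ Ω A) →
  IsCharacteristic ((F ^*₁) (true B)) υ →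
  ∀ {a d} (S : Sieve B (Functor.F₀ F a)) (h : Category.Hom A d a) →
  Sieve.mem (_⇒_.η υ a S) h ⇔ Sieve.mem S (Functor.F₁ F h)
inverse-image-member {B = B} F υ isυ S h =
  ⇔.trans (Characteristic.member⇔in-image ((F ^*₁) (true B)) υ isυ S h)
          (⇔.trans (mk⇔ proj₂ (λ e → UP.tt , e))
                   (⇔.sym (member⇔pullback-maximal S (Functor.F₁ F h))))

module _ (C D : Category) (υ : (proj C D ^*) (Ω C) ⇒ Ω (C ⊗ D))
         (isυ : IsCharacteristic ((proj C D ^*₁) (true C)) υ) where
  private module D = Category D

  -- υ is a monomorphism: a sieve S is recovered from υ(S) by testing (f, id).
  υ-cancel : ∀ {P} (φ ψ : P ⇒ (proj C D ^*) (Ω C)) → υ ∘ⁿ φ ≈ⁿ υ ∘ⁿ ψ → φ ≈ⁿ ψ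
  υ-cancel φ ψ e (c , k) x = sieve-ext {S = S} {T = T} λ f →
      ⇔.trans (⇔.sym (member-at-id S f))
      (⇔.trans (≈ˢ⇒member⇔ {S = υ.η (c , k) S} {T = υ.η (c , k) T} (e (c , k) x) (f , D.id))
               (member-at-id T f))
    where
      module υ = _⇒_ υ
      S T : Sieve C c
      S = _⇒_.η φ (c , k) x
      T = _⇒_.η ψ (c , k) x
      member-at-id : (R : Sieve C c) {d : Category.Obj C} (f : Category.Hom C d c) →
                     Sieve.mem (υ.η (c , k) R) (f , D.id) ⇔ Sieve.mem R f
      member-at-id R f = inverse-image-member (proj C D) υ isυ R (f , D.id)

  -- Both χδ and υ ∘ π^*(χδ′) send (x, y) to the sieve of the (f, g) with x·f ≈ y·f.
  diagonal-factors : (Y : Presheaf C)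
    (χδ : (proj C D ^*) Y ×ₚ (proj C D ^*) Y ⇒ Ω (C ⊗ D)) →
    IsCharacteristic (diag ((proj C D ^*) Y)) χδ →
    (χδ′ : Y ×ₚ Y ⇒ Ω C) → IsCharacteristic (diag Y) χδ′ →
    χδ ≈ⁿ υ ∘ⁿ (proj C D ^*₁) χδ′
  diagonal-factors Y χδ isδ χδ′ isδ′ (c , k) x =
    sieve-ext {S = _⇒_.η χδ (c , k) x} {T = _⇒_.η υ (c , k) (_⇒_.η χδ′ c x)} λ fg →
      ⇔.trans (diagonal-member ((proj C D ^*) Y) χδ isδ x fg)
      (⇔.trans (⇔.sym (diagonal-member Y χδ′ isδ′ x (proj₁ fg)))
               (⇔.sym (inverse-image-member (proj C D) υ isυ (_⇒_.η χδ′ c x) fg)))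

mainTheorem10 : (C D : Category) (Y : Presheaf C)
    (υ : (proj C D ^*) (Ω C) ⇒ Ω (C ⊗ D))
    → IsCharacteristic ((proj C D ^*₁) (true C)) υ
    → (χδ : (proj C D ^*) Y ×ₚ (proj C D ^*) Y ⇒ Ω (C ⊗ D))
    → IsCharacteristic (diag ((proj C D ^*) Y)) χδ
    → (χδ′ : Y ×ₚ Y ⇒ Ω C)
    → IsCharacteristic (diag Y) χδ′
    → (χδ ≈ⁿ υ ∘ⁿ (proj C D ^*₁) χδ′)
    × ((φ : (proj C D ^*) Y ×ₚ (proj C D ^*) Y ⇒ (proj C D ^*) (Ω C))
    → χδ ≈ⁿ υ ∘ⁿ φ → φ ≈ⁿ (proj C D ^*₁) χδ′)
mainTheorem10 C D Y υ isυ χδ isδ χδ′ isδ′ = factors , unique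
  where
    factors : χδ ≈ⁿ υ ∘ⁿ (proj C D ^*₁) χδ′
    factors = diagonal-factors C D υ isυ Y χδ isδ χδ′ isδ′

    unique : (φ : (proj C D ^*) Y ×ₚ (proj C D ^*) Y ⇒ (proj C D ^*) (Ω C))
           → χδ ≈ⁿ υ ∘ⁿ φ → φ ≈ⁿ (proj C D ^*₁) χδ′
    unique φ χδ≈υφ = υ-cancel C D υ isυ φ ((proj C D ^*₁) χδ′)
                       (≈ⁿ-trans {α = υ ∘ⁿ φ} {β = χδ} {γ = υ ∘ⁿ (proj C D ^*₁) χδ′}
                         (≈ⁿ-sym {α = χδ} {β = υ ∘ⁿ φ} χδ≈υφ) factors)
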